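{- With $V=\sum_{n\ge0}\sum_{\pi\in\mathcal R_{2n}}\mathbf G_\pi$ and $W=\sum_{n\ge0}\sum_{\pi\in\mathcal R_{2n+1}}\mathbf G_\pi$, $$V(1-W)^{ -1}=\sum_{n\ge0}\sum_{\pi\in\mathcal V_n}\mathbf G_\pi .$$
   Context: A signed permutation of size $n$ is a word $\pi=\pi_1\cdots\pi_n$ over the integers such that $|\pi_1|,\dots,|\pi_n|$ is a permutation of $\{1,\dots,n\}$ (written $(\sigma,\epsilon)$, $\pi_i=\epsilon_i\sigma(i)$); $-k$ is written $\bar k$; letters are compared as integers. For a word $w$ of distinct integers, $\mathrm{std}(w)$ is the permutation with the same relative order. ${\bf FQSym}^{(2)}$ is the algebra with basis $\mathbf G_{(\sigma,\epsilon)}$ indexed by signed permutations of all sizes (unit $\mathbf G_\emptyset=1$), with product $\mathbf{G}_{(\alpha,\epsilon)}\mathbf{G}_{(\beta,\eta)}=\sum_{\gamma}\mathbf{G}_{(\gamma,\epsilon\cdot\eta)}$, the sum over $\gamma\in\mathfrak S_{k+l}$ with $\mathrm{std}(\gamma_1\cdots\gamma_k)=\alpha$, $\mathrm{std}(\gamma_{k+1}\cdots\gamma_{k+l})=\beta$ ($k,l$ the sizes), $\epsilon\cdot\eta$ the concatenation; formal infinite sums are allowed. $\mathcal R_{2n}$ is the set of signed permutations $\pi$ of size $2n$ with $|\pi_1|<|\pi_2|>|\pi_3|<\cdots<|\pi_{2n}|$ and, for every $1\le i\le 2n$, $\pi_i>0$ iff $i$ is odd ($\mathcal R_0=\{\emptyset\}$).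 $\mathcal R_{2n+1}$ is the set of signed permutations $\pi$ of size $2n+1$ with $|\pi_1|>|\pi_2|<|\pi_3|>\cdots<|\pi_{2n+1}|$, $\pi_1>0$, and for every $2\le i\le 2n+1$, $\pi_i>0$ iff $i$ is even. A signed permutation $\pi$ of size $n$ is valley-signed if for every $i$, $\pi_i<0$ implies either ($i>2$, $\pi_{i-1}>0$, and $|\pi_{i-2}|>\pi_{i-1}<|\pi_i|$) or ($i=2$ and $0<\pi_1<|\pi_2|$); $\mathcal V_n$ is the set of valley-signed permutations of size $n$. -}

module Defs where

open import Data.Bool using (Bool; true; false; _∧_; _∨_; not; if_then_else_; T)
open import Data.Nat as ℕ using (ℕ; zero; suc; _*_; _<ᵇ_; _≡ᵇ_; _∸_)
open import Data.Integer as ℤ using (ℤ; +_; -[1+_]; ∣_∣; _≤ᵇ_; 0ℤ; 1ℤ)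
open import Data.List using (List; []; _∷_; map; length; take; drop; zipWith; upTo)
open import Data.Nat.ListAction using (sum)
open import Data.Bool.ListAction using (all; any)

-- A signed permutation of size n is represented by the word π₁⋯πₙ
-- of integers (a list of integers); negative letters are the barred ones.
Word : Set
Word = List ℤ

_<ℤ_ : ℤ → ℤ → Bool
a <ℤ b = (a ℤ.+ 1ℤ) ≤ᵇ b

pos : ℤ → Bool
pos a = 0ℤ <ℤ a

neg : ℤ → Bool
neg a = a <ℤ 0ℤ

positions : ℕ → List ℕ
positions n = map suc (upTo n)

-- is the word a signed permutation: |π₁|,…,|πₙ| is a permutation of {1..n}
-- (each k ∈ {1..n} occurs among the |πᵢ|, and there are exactly n letters)
isSignedPermᵇ : Word → Bool
isSignedPermᵇ w = all (λ k → any (λ x → ∣ x ∣ ≡ᵇ k) w) (positions (length w))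

IsSignedPerm : Word → Set
IsSignedPerm w = T (isSignedPermᵇ w)

countLess : ℕ → List ℕ → ℕ
countLess x [] = 0
countLess x (y ∷ ys) = if y <ᵇ x then suc (countLess x ys) else countLess x ys

std : List ℕ → List ℕ
std ws = map (λ x → suc (countLess x ws)) ws

withSignOf : ℤ → ℕ → ℤ
withSignOf (+ _)    k = + k
withSignOf -[1+ _ ] k = ℤ.- (+ k)

stdS : Word → Word
stdS w = zipWith withSignOf w (std (map ∣_∣ w))

-- Formal (infinite) sums  Σ_π c_π G_π  of FQSym^(2), with ℕ coefficients:
-- a series is its coefficient function (only values on signed
-- permutations are meaningful).

Series : Set
Series = Word → ℕ

one : Series
one [] = 1
one (_ ∷ _) = 0

-- Product: G_(α,ε) G_(β,η) = Σ_γ G_(γ,ε·η).  Hence the coefficient of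
-- G_π (π of size m) in A·B is Σ_{k=0}^{m} A(stdS(π₁⋯π_k)) · B(stdS(π_{k+1}⋯π_m)).
_⊛_ : Series → Series → Series
(A ⊛ B) w = sum (map (λ k → A (stdS (take k w)) * B (stdS (drop k w))) (upTo (suc (length w))))

infixl 7 _⊛_

_^ˢ_ : Series → ℕ → Series
A ^ˢ zero = one
A ^ˢ suc k = (A ^ˢ k) ⊛ A

-- (1 - W)⁻¹ = Σ_{k≥0} W^k for a series W without constant term; in degree m
-- only k ≤ m contribute (W^k is concentrated in degrees ≥ k).
geomInv : Series → Series
geomInv W w = sum (map (λ k → (W ^ˢ k) w) (upTo (suc (length w))))

𝟙 : Bool → ℕ
𝟙 true = 1
𝟙 false = 0

evenᵇ : ℕ → Bool
evenᵇ zero = true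
evenᵇ (suc n) = not (evenᵇ n)

alt : Bool → List ℕ → Bool
alt b [] = true
alt b (x ∷ []) = true
alt b (x ∷ y ∷ r) = (if b then x <ᵇ y else y <ᵇ x) ∧ alt (not b) (y ∷ r)

signPat : Bool → Word → Bool
signPat b [] = true
signPat b (x ∷ r) = (if b then pos x else not (pos x)) ∧ signPat (not b) r

inREvenᵇ : Word → Bool
inREvenᵇ w = isSignedPermᵇ w ∧ evenᵇ (length w) ∧ alt true (map ∣_∣ w) ∧ signPat true w

inROddᵇ : Word → Bool
inROddᵇ [] = false
inROddᵇ (x ∷ r) = isSignedPermᵇ (x ∷ r) ∧ not (evenᵇ (length (x ∷ r)))
                  ∧ alt false (map ∣_∣ (x ∷ r)) ∧ pos x ∧ signPat true r

-- π_i (1-based), 0 outside the range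
at : Word → ℕ → ℤ
at [] _ = 0ℤ
at (x ∷ _) zero = 0ℤ
at (x ∷ _) (suc zero) = x
at (_ ∷ r) (suc (suc i)) = at r (suc i)

absℤ : ℤ → ℤ
absℤ a = + ∣ a ∣

valleyCond : Word → ℕ → Bool
valleyCond w i =
  not (neg (at w i))
  ∨ ((2 <ᵇ i) ∧ pos (at w (i ∸ 1))
       ∧ (at w (i ∸ 1) <ℤ absℤ (at w (i ∸ 2))) ∧ (at w (i ∸ 1) <ℤ absℤ (at w i)))
  ∨ ((i ≡ᵇ 2) ∧ (0ℤ <ℤ at w 1) ∧ (at w 1 <ℤ absℤ (at w 2)))

inVᵇ : Word → Bool
inVᵇ w = isSignedPermᵇ w ∧ all (valleyCond w) (positions (length w))

Vser : Series
Vser w = 𝟙 (inREvenᵇ w)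

Wser : Series
Wser w = 𝟙 (inROddᵇ w)

ValleySer : Series
ValleySer w = 𝟙 (inVᵇ w)

module Submission where

-- If the letters of u have distinct nonzero absolute values, the coefficients of V and W at
-- std(u) depend only on the zigzag-and-sign shape of u, and standardisation commutes with
-- taking prefixes and suffixes.  So the coefficient of G_π in V (1 - W)⁻¹ counts the
-- factorisations π = e o₁ ⋯ oⱼ of π itself with e of R-even shape and each oᵢ of R-odd shape.
-- Reading π letter by letter, this count and the count of factorisations whose last factor
-- still awaits a letter satisfy a two-state recursion: a positive letter always extends a
-- complete factorisation, a negative letter must complete a pending one by an ascent.  The
-- indicators of "valley-signed" and "valley-signed and ending in a descent to a positive
-- letter" satisfy the same recursion, so the two pairs agree.

open import Defs

open import Algebra.Bundles using (CommutativeMonoid)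
open import Data.Bool using (Bool; true; false; _∧_; _∨_; not; if_then_else_; T)
open import Data.Bool.ListAction using (all)
open import Data.Bool.Properties using (T-≡; ∧-identityʳ; ∧-zeroʳ; ∧-assoc; ∧-comm; ∨-identityʳ; ∧-commutativeMonoid)
open import Algebra.Properties.CommutativeSemigroup (CommutativeMonoid.commutativeSemigroup ∧-commutativeMonoid)
  using () renaming (interchange to ∧-interchange)
open import Data.Integer as ℤ using (ℤ; +_; -[1+_]; ∣_∣; 0ℤ)
open import Data.List using (List; []; _∷_; _++_; [_]; map; length; take; drop; zipWith; upTo)
open import Data.List.Properties
  using ( length-++; length-map; length-take; length-upTo; length-removeAt′; map-∘; map-cong-local; map-++
        ; map-applyUpTo; map-upTo; upTo-∷ʳ; take-map; drop-map; take-all; drop-all; drop-[])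
open import Data.List.Membership.Propositional using (_∈_; _∉_; _─_)
open import Data.List.Membership.Propositional.Properties using (∈-map⁺; ∈-map⁻; ∈-upTo⁺; ∈-upTo⁻)
open import Data.List.Relation.Binary.Subset.Propositional using (_⊆_)
open import Data.List.Relation.Unary.All as All using (All; []; _∷_)
open import Data.List.Relation.Unary.All.Properties using (─⁺; ¬Any⇒All¬; all⁺; all⁻; ∷ʳ⁻)
import Data.List.Relation.Unary.All.Properties as Allₚ
open import Data.List.Relation.Unary.AllPairs using ([]; _∷_)
open import Data.List.Relation.Unary.Any as Any using (here; there; index)
open import Data.List.Relation.Unary.Any.Properties using (any⁺; any⁻)
import Data.List.Relation.Unary.Any.Properties as Anyₚ
open import Data.List.Relation.Unary.Unique.Propositional using (Unique)
import Data.List.Relation.Unary.Unique.Propositional.Properties as Uniqueₚ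
open import Data.List.Reverse using (Reverse; []; _∶_∶ʳ_; reverseView)
open import Data.Nat using (ℕ; zero; suc; _+_; _*_; _∸_; _≤_; _<_; _≥_; z≤n; s≤s; _<ᵇ_; _≡ᵇ_)
open import Data.Nat.ListAction using (sum)
open import Data.Nat.ListAction.Properties using (sum-++)
open import Data.Nat.Properties
open import Algebra.Properties.CommutativeSemigroup *-commutativeSemigroup using (x∙yz≈y∙xz)
open import Data.Nat.Solver using (module +-*-Solver)
open +-*-Solver using (solve; _:+_; _:*_; _:=_; con)
open import Data.List.Membership.DecPropositional _≟_ using (_∈?_)
open import Data.Product using (_×_; _,_; proj₁; proj₂)
open import Function using (_∘_; Equivalence)
open import Relation.Binary.Definitions using (tri<; tri≈; tri>)
open import Relation.Binary.PropositionalEquality hiding ([_])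
open import Relation.Nullary using (yes; no; contradiction)

Σ : ℕ → (ℕ → ℕ) → ℕ
Σ n f = sum (map f (upTo n))

Σ-suc : ∀ n f → Σ (suc n) f ≡ Σ n f + f n
Σ-suc n f = begin
  sum (map f (upTo (suc n)))      ≡⟨ cong (λ l → sum (map f l)) (upTo-∷ʳ n) ⟨
  sum (map f (upTo n ++ [ n ]))   ≡⟨ cong sum (map-++ f (upTo n) [ n ]) ⟩
  sum (map f (upTo n) ++ [ f n ]) ≡⟨ sum-++ (map f (upTo n)) [ f n ] ⟩
  Σ n f + (f n + 0)               ≡⟨ cong (λ t → Σ n f + t) (+-identityʳ (f n)) ⟩
  Σ n f + f n                     ∎
  where open ≡-Reasoning

Σ-shift : ∀ n f → Σ (suc n) f ≡ f 0 + Σ n (λ k → f (suc k))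
Σ-shift n f = cong (λ l → f 0 + sum l)
  (trans (map-applyUpTo suc f n) (sym (map-upTo (λ k → f (suc k)) n)))

Σ-cong : ∀ n {f g : ℕ → ℕ} → (∀ k → k < n → f k ≡ g k) → Σ n f ≡ Σ n g
Σ-cong zero    eq = refl
Σ-cong (suc n) {f} {g} eq = begin
  Σ (suc n) f ≡⟨ Σ-suc n f ⟩
  Σ n f + f n ≡⟨ cong₂ _+_ (Σ-cong n (λ k k<n → eq k (m<n⇒m<1+n k<n))) (eq n ≤-refl) ⟩
  Σ n g + g n ≡⟨ Σ-suc n g ⟨
  Σ (suc n) g ∎
  where open ≡-Reasoning

Σ-distrib-+ : ∀ n (f g : ℕ → ℕ) → Σ n (λ k → f k + g k) ≡ Σ n f + Σ n g
Σ-distrib-+ zero    f g = refl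
Σ-distrib-+ (suc n) f g = begin
  Σ (suc n) (λ k → f k + g k)          ≡⟨ Σ-suc n _ ⟩
  Σ n (λ k → f k + g k) + (f n + g n)  ≡⟨ cong (_+ (f n + g n)) (Σ-distrib-+ n f g) ⟩
  (Σ n f + Σ n g) + (f n + g n)        ≡⟨ solve 4 (λ a b c d → (a :+ b) :+ (c :+ d) := (a :+ c) :+ (b :+ d))
                                            refl (Σ n f) (Σ n g) (f n) (g n) ⟩
  (Σ n f + f n) + (Σ n g + g n)        ≡⟨ cong₂ _+_ (Σ-suc n f) (Σ-suc n g) ⟨
  Σ (suc n) f + Σ (suc n) g            ∎
  where open ≡-Reasoning

Σ-*ˡ : ∀ n c (f : ℕ → ℕ) → Σ n (λ k → c * f k) ≡ c * Σ n f
Σ-*ˡ zero    c f = sym (*-zeroʳ c)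
Σ-*ˡ (suc n) c f = begin
  Σ (suc n) (λ k → c * f k)      ≡⟨ Σ-suc n _ ⟩
  Σ n (λ k → c * f k) + c * f n  ≡⟨ cong (_+ c * f n) (Σ-*ˡ n c f) ⟩
  c * Σ n f + c * f n            ≡⟨ *-distribˡ-+ c (Σ n f) (f n) ⟨
  c * (Σ n f + f n)              ≡⟨ cong (c *_) (Σ-suc n f) ⟨
  c * Σ (suc n) f                ∎
  where open ≡-Reasoning

Σ-zero : ∀ n {f : ℕ → ℕ} → (∀ k → k < n → f k ≡ 0) → Σ n f ≡ 0
Σ-zero zero    _ = refl
Σ-zero (suc n) {f} vanishes = begin
  Σ (suc n) f  ≡⟨ Σ-suc n f ⟩
  Σ n f + f n  ≡⟨ cong₂ _+_ (Σ-zero n (λ k k<n → vanishes k (m<n⇒m<1+n k<n))) (vanishes n ≤-refl) ⟩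
  0            ∎
  where open ≡-Reasoning

Σ-last : ∀ n {f : ℕ → ℕ} → (∀ k → k < n → f k ≡ 0) → Σ (suc n) f ≡ f n
Σ-last n {f} vanishes = trans (Σ-suc n f) (cong (_+ f n) (Σ-zero n vanishes))

Σ-extend : ∀ n d {f : ℕ → ℕ} → (∀ k → n ≤ k → f k ≡ 0) → Σ (d + n) f ≡ Σ n f
Σ-extend n zero    vanishes = refl
Σ-extend n (suc d) {f} vanishes = begin
  Σ (suc (d + n)) f       ≡⟨ Σ-suc (d + n) f ⟩
  Σ (d + n) f + f (d + n) ≡⟨ cong₂ _+_ (Σ-extend n d vanishes) (vanishes (d + n) (m≤n+m n d)) ⟩
  Σ n f + 0               ≡⟨ +-identityʳ (Σ n f) ⟩
  Σ n f                   ∎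
  where open ≡-Reasoning

-- Pigeonhole principle for lists

∈-─⁻ : ∀ {v : ℕ} {xs x} (p : v ∈ xs) → x ∈ xs ─ p → x ∈ xs
∈-─⁻ (here _)  q         = there q
∈-─⁻ (there p) (here eq) = here eq
∈-─⁻ (there p) (there q) = there (∈-─⁻ p q)

∈-─⁺ : ∀ {v : ℕ} {xs x} (p : v ∈ xs) → x ∈ xs → x ≢ v → x ∈ xs ─ p
∈-─⁺ (here refl) (here refl) x≢v = contradiction refl x≢v
∈-─⁺ (here refl) (there q)   x≢v = q
∈-─⁺ (there p)   (here eq)   x≢v = here eq
∈-─⁺ (there p)   (there q)   x≢v = there (∈-─⁺ p q x≢v)

Unique-─ : ∀ {v : ℕ} {xs} (p : v ∈ xs) → Unique xs → Unique (xs ─ p)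
Unique-─ (here _)  (_ ∷ u)  = u
Unique-─ (there p) (a ∷ u)  = ─⁺ p a ∷ Unique-─ p u

∉-─ : ∀ {v : ℕ} {xs} (p : v ∈ xs) → Unique xs → v ∉ xs ─ p
∉-─ (here refl) (v∉ ∷ _) q         = All.lookup v∉ q refl
∉-─ (there p)   (k∉ ∷ _) (here refl) = All.lookup k∉ p refl
∉-─ (there p)   (_ ∷ u)  (there q) = ∉-─ p u q

Unique-⊆⇒length-≤ : ∀ {ks vs : List ℕ} → Unique ks → ks ⊆ vs → length ks ≤ length vs
Unique-⊆⇒length-≤ {[]}     _         _    = z≤n
Unique-⊆⇒length-≤ {k ∷ ks} {vs} (k∉ ∷ u) ks⊆vs =
  subst (suc (length ks) ≤_) (sym (length-removeAt′ vs (index k∈vs)))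
    (s≤s (Unique-⊆⇒length-≤ u λ x∈ks →
      ∈-─⁺ k∈vs (ks⊆vs (there x∈ks)) λ x≡k → All.lookup k∉ x∈ks (sym x≡k)))
  where k∈vs : k ∈ vs
        k∈vs = ks⊆vs (here refl)

pigeonhole : ∀ {ks vs : List ℕ} → Unique ks → ks ⊆ vs → length vs ≤ length ks → Unique vs × vs ⊆ ks
pigeonhole {ks} {[]}     _ _     _ = [] , λ ()
pigeonhole {ks} {v ∷ vs} u ks⊆ len with v ∈? ks
... | yes v∈ks =
  let uvs , vs⊆ = pigeonhole (Unique-─ v∈ks u) ks─⊆vs
                    (≤-pred (subst (suc (length vs) ≤_) (length-removeAt′ ks (index v∈ks)) len))
  in ¬Any⇒All¬ vs (λ v∈vs → ∉-─ v∈ks u (vs⊆ v∈vs)) ∷ uvs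
   , λ { (here refl) → v∈ks ; (there x∈vs) → ∈-─⁻ v∈ks (vs⊆ x∈vs) }
  where
  ks─⊆vs : ks ─ v∈ks ⊆ vs
  ks─⊆vs x∈ with ks⊆ (∈-─⁻ v∈ks x∈)
  ... | here refl = contradiction x∈ (∉-─ v∈ks u)
  ... | there x∈vs = x∈vs
... | no v∉ks = contradiction len (<⇒≱ (s≤s (Unique-⊆⇒length-≤ u ks⊆vs)))
  where
  ks⊆vs : ks ⊆ vs
  ks⊆vs x∈ with ks⊆ x∈
  ... | here refl = contradiction x∈ v∉ks
  ... | there x∈vs = x∈vs

-- Standardisation

<ᵇ-≡true : ∀ {m n} → m < n → (m <ᵇ n) ≡ true
<ᵇ-≡true m<n = Equivalence.to T-≡ (<⇒<ᵇ m<n)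

<ᵇ-≡false : ∀ {m n} → n ≤ m → (m <ᵇ n) ≡ false
<ᵇ-≡false {m} {n} n≤m with m <ᵇ n in eq
... | false = refl
... | true  = contradiction n≤m (<⇒≱ (<ᵇ⇒< m n (Equivalence.from T-≡ eq)))

<ᵇ-≡⇒< : ∀ {m n} → (m <ᵇ n) ≡ true → m < n
<ᵇ-≡⇒< {m} {n} eq = <ᵇ⇒< m n (Equivalence.from T-≡ eq)

<ᵇ-≡⇒≥ : ∀ {m n} → (m <ᵇ n) ≡ false → n ≤ m
<ᵇ-≡⇒≥ {m} {n} eq = ≮⇒≥ λ m<n → subst T eq (<⇒<ᵇ m<n)

rank : List ℕ → ℕ → ℕ
rank as x = suc (countLess x as)

countLess-≤ : ∀ x as → countLess x as ≤ length as
countLess-≤ x []       = z≤n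
countLess-≤ x (a ∷ as) with a <ᵇ x
... | true  = s≤s (countLess-≤ x as)
... | false = m≤n⇒m≤1+n (countLess-≤ x as)

countLess-< : ∀ {x as} → x ∈ as → countLess x as < length as
countLess-< {x} {a ∷ as} (here refl) rewrite <ᵇ-≡false {x} {x} ≤-refl = s≤s (countLess-≤ x as)
countLess-< {x} {a ∷ as} (there x∈) with a <ᵇ x
... | true  = s≤s (countLess-< x∈)
... | false = m≤n⇒m≤1+n (countLess-< x∈)

countLess-mono : ∀ {y x} as → y ≤ x → countLess y as ≤ countLess x as
countLess-mono [] _ = z≤n
countLess-mono {y} {x} (a ∷ as) y≤x with a <ᵇ y in a<y | a <ᵇ x in a<x
... | true  | true  = s≤s (countLess-mono as y≤x)
... | true  | false = contradiction (<-≤-trans (<ᵇ-≡⇒< a<y) y≤x) (≤⇒≯ (<ᵇ-≡⇒≥ a<x))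
... | false | true  = m≤n⇒m≤1+n (countLess-mono as y≤x)
... | false | false = countLess-mono as y≤x

countLess-strict : ∀ {y as x} → y ∈ as → y < x → countLess y as < countLess x as
countLess-strict {y} {a ∷ as} {x} (here refl) y<x rewrite <ᵇ-≡false {y} {y} ≤-refl | <ᵇ-≡true y<x =
  s≤s (countLess-mono as (<⇒≤ y<x))
countLess-strict {y} {a ∷ as} {x} (there y∈) y<x with a <ᵇ y in a<y | a <ᵇ x in a<x
... | true  | true  = s≤s (countLess-strict y∈ y<x)
... | true  | false = contradiction (<-trans (<ᵇ-≡⇒< a<y) y<x) (≤⇒≯ (<ᵇ-≡⇒≥ a<x))
... | false | true  = m≤n⇒m≤1+n (countLess-strict y∈ y<x)
... | false | false = countLess-strict y∈ y<x

_PreservesOrderOn_ : (ℕ → ℕ) → List ℕ → Set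
f PreservesOrderOn as = ∀ {x y} → x ∈ as → y ∈ as → (f x <ᵇ f y) ≡ (x <ᵇ y)

rank-preservesOrder : ∀ as → rank as PreservesOrderOn as
rank-preservesOrder as {x} {y} x∈ _ with x <ᵇ y in x<y
... | true  = <ᵇ-≡true (countLess-strict x∈ (<ᵇ-≡⇒< x<y))
... | false = <ᵇ-≡false (countLess-mono as (<ᵇ-≡⇒≥ x<y))

countLess-map : ∀ (f : ℕ → ℕ) x ys → (∀ {y} → y ∈ ys → (f y <ᵇ f x) ≡ (y <ᵇ x)) →
                countLess (f x) (map f ys) ≡ countLess x ys
countLess-map f x []       _    = refl
countLess-map f x (y ∷ ys) pres rewrite pres (here refl) with y <ᵇ x
... | true  = cong suc (countLess-map f x ys (pres ∘ there))
... | false = countLess-map f x ys (pres ∘ there)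

std-map : ∀ f as → f PreservesOrderOn as → std (map f as) ≡ std as
std-map f as pres = trans (sym (map-∘ as)) (map-cong-local (All.tabulate λ x∈ →
  cong suc (countLess-map f _ as λ y∈ → pres y∈ x∈)))

relabel : (ℕ → ℕ) → Word → Word
relabel f = map λ x → withSignOf x (f ∣ x ∣)

∣withSignOf∣ : ∀ x k → ∣ withSignOf x k ∣ ≡ k
∣withSignOf∣ (+ _)    k       = refl
∣withSignOf∣ -[1+ _ ] zero    = refl
∣withSignOf∣ -[1+ _ ] (suc k) = refl

∣relabel∣ : ∀ f u → map ∣_∣ (relabel f u) ≡ map f (map ∣_∣ u)
∣relabel∣ f []      = refl
∣relabel∣ f (x ∷ u) = cong₂ _∷_ (∣withSignOf∣ x (f ∣ x ∣)) (∣relabel∣ f u)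

length-relabel : ∀ f u → length (relabel f u) ≡ length u
length-relabel f u = length-map _ u

stdS≡relabel : ∀ u → stdS u ≡ relabel (rank (map ∣_∣ u)) u
stdS≡relabel u = go u
  where
  go : ∀ s → zipWith withSignOf s (map (rank (map ∣_∣ u)) (map ∣_∣ s)) ≡ relabel (rank (map ∣_∣ u)) s
  go []      = refl
  go (x ∷ s) = cong (_ ∷_) (go s)

withSignOf-idem : ∀ x m k → withSignOf (withSignOf x (suc m)) k ≡ withSignOf x k
withSignOf-idem (+ _)    m k = refl
withSignOf-idem -[1+ _ ] m k = refl

stdS-relabel : ∀ (g : ℕ → ℕ) s → (λ n → suc (g n)) PreservesOrderOn map ∣_∣ s →
               stdS (relabel (λ n → suc (g n)) s) ≡ stdS s
stdS-relabel g s pres = begin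
  zipWith withSignOf (relabel f s) (std (map ∣_∣ (relabel f s)))
    ≡⟨ cong (zipWith withSignOf (relabel f s) ∘ std) (∣relabel∣ f s) ⟩
  zipWith withSignOf (relabel f s) (std (map f (map ∣_∣ s)))
    ≡⟨ cong (zipWith withSignOf (relabel f s)) (std-map f (map ∣_∣ s) pres) ⟩
  zipWith withSignOf (relabel f s) (std (map ∣_∣ s))
    ≡⟨ resign s (std (map ∣_∣ s)) ⟩
  stdS s ∎
  where
  open ≡-Reasoning
  f : ℕ → ℕ
  f n = suc (g n)
  resign : ∀ s cs → zipWith withSignOf (relabel f s) cs ≡ zipWith withSignOf s cs
  resign []      cs       = refl
  resign (x ∷ s) []       = refl
  resign (x ∷ s) (c ∷ cs) = cong₂ _∷_ (withSignOf-idem x (g ∣ x ∣) c) (resign s cs)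

stdS-subword : ∀ {s} u → (∀ {n} → n ∈ map ∣_∣ s → n ∈ map ∣_∣ u) →
               stdS (relabel (rank (map ∣_∣ u)) s) ≡ stdS s
stdS-subword {s} u sub = stdS-relabel (λ n → countLess n (map ∣_∣ u)) s
  λ x∈ y∈ → rank-preservesOrder (map ∣_∣ u) (sub x∈) (sub y∈)

∈-take⁻ : ∀ {A : Set} {a : A} k xs → a ∈ take k xs → a ∈ xs
∈-take⁻ (suc k) (x ∷ xs) (here eq)  = here eq
∈-take⁻ (suc k) (x ∷ xs) (there a∈) = there (∈-take⁻ k xs a∈)

∈-drop⁻ : ∀ {A : Set} {a : A} k xs → a ∈ drop k xs → a ∈ xs
∈-drop⁻ zero    xs       a∈ = a∈
∈-drop⁻ (suc k) (x ∷ xs) a∈ = there (∈-drop⁻ k xs a∈)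

stdS-take : ∀ k u → stdS (take k (stdS u)) ≡ stdS (take k u)
stdS-take k u = begin
  stdS (take k (stdS u))                   ≡⟨ cong (stdS ∘ take k) (stdS≡relabel u) ⟩
  stdS (take k (relabel (rank ∣u∣) u))     ≡⟨ cong stdS (take-map k u) ⟩
  stdS (relabel (rank ∣u∣) (take k u))     ≡⟨ stdS-subword u (λ n∈ → ∈-take⁻ k ∣u∣
                                                (subst (_ ∈_) (sym (take-map k u)) n∈)) ⟩
  stdS (take k u)                          ∎
  where open ≡-Reasoning
        ∣u∣ : List ℕ
        ∣u∣ = map ∣_∣ u

stdS-drop : ∀ k u → stdS (drop k (stdS u)) ≡ stdS (drop k u)
stdS-drop k u = begin
  stdS (drop k (stdS u))                   ≡⟨ cong (stdS ∘ drop k) (stdS≡relabel u) ⟩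
  stdS (drop k (relabel (rank ∣u∣) u))     ≡⟨ cong stdS (drop-map k u) ⟩
  stdS (relabel (rank ∣u∣) (drop k u))     ≡⟨ stdS-subword u (λ n∈ → ∈-drop⁻ k ∣u∣
                                                (subst (_ ∈_) (sym (drop-map k u)) n∈)) ⟩
  stdS (drop k u)                          ∎
  where open ≡-Reasoning
        ∣u∣ : List ℕ
        ∣u∣ = map ∣_∣ u

length-stdS : ∀ u → length (stdS u) ≡ length u
length-stdS u = trans (cong length (stdS≡relabel u)) (length-relabel (rank (map ∣_∣ u)) u)

∣stdS∣ : ∀ u → map ∣_∣ (stdS u) ≡ std (map ∣_∣ u)
∣stdS∣ u = trans (cong (map ∣_∣) (stdS≡relabel u)) (∣relabel∣ (rank (map ∣_∣ u)) u)

Good : Word → Set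
Good u = Unique (map ∣_∣ u) × All (_≢ 0ℤ) u

good-take : ∀ k u → Good u → Good (take k u)
good-take k u (uniq , nz) = subst Unique (take-map k u) (Uniqueₚ.take⁺ k uniq) , Allₚ.take⁺ k nz

good-drop : ∀ k u → Good u → Good (drop k u)
good-drop k u (uniq , nz) = subst Unique (drop-map k u) (Uniqueₚ.drop⁺ k uniq) , Allₚ.drop⁺ k nz

∈-positions⁺ : ∀ {i n} → i < n → suc i ∈ positions n
∈-positions⁺ i<n = ∈-map⁺ suc (∈-upTo⁺ i<n)

∈-positions⁻ : ∀ {k n} → k ∈ positions n → k ≢ 0
∈-positions⁻ k∈ with ∈-map⁻ suc k∈
... | _ , _ , refl = λ ()

length-positions : ∀ n → length (positions n) ≡ n
length-positions n = trans (length-map suc (upTo n)) (length-upTo n)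

unique-positions : ∀ n → Unique (positions n)
unique-positions n = Uniqueₚ.map⁺ suc-injective (Uniqueₚ.upTo⁺ n)

isSignedPerm⁻ : ∀ w → IsSignedPerm w → positions (length w) ⊆ map ∣_∣ w
isSignedPerm⁻ w sp k∈ =
  Anyₚ.map⁺ (Any.map (λ eq → sym (≡ᵇ⇒≡ _ _ eq)) (any⁻ _ w (All.lookup (all⁺ _ _ sp) k∈)))

isSignedPerm⁺ : ∀ w → positions (length w) ⊆ map ∣_∣ w → IsSignedPerm w
isSignedPerm⁺ w covers = all⁻ _ (All.tabulate λ k∈ →
  any⁺ _ (Any.map (λ { {x} refl → ≡⇒≡ᵇ ∣ x ∣ ∣ x ∣ refl }) (Anyₚ.map⁻ (covers k∈))))

signedPerm⇒good : ∀ π → IsSignedPerm π → Good π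
signedPerm⇒good π sp
  with pigeonhole (unique-positions (length π)) (isSignedPerm⁻ π sp)
         (≤-reflexive (trans (length-map ∣_∣ π) (sym (length-positions (length π)))))
... | unique , ⊆positions =
  unique , All.tabulate λ x∈ x≡0 → ∈-positions⁻ (⊆positions (∈-map⁺ ∣_∣ x∈)) (cong ∣_∣ x≡0)

Unique-map : ∀ (f : ℕ → ℕ) {xs} → (∀ {x y} → x ∈ xs → y ∈ xs → f x ≡ f y → x ≡ y) →
             Unique xs → Unique (map f xs)
Unique-map f {[]}     inj []         = []
Unique-map f {x ∷ xs} inj (x∉ ∷ uniq) =
  Allₚ.map⁺ (All.tabulate λ y∈ fx≡fy → All.lookup x∉ y∈ (inj (here refl) (there y∈) fx≡fy))
  ∷ Unique-map f (λ x∈ y∈ → inj (there x∈) (there y∈)) uniq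

rank-injectiveOn : ∀ as {x y} → x ∈ as → y ∈ as → rank as x ≡ rank as y → x ≡ y
rank-injectiveOn as {x} {y} x∈ y∈ eq with <-cmp x y
... | tri< x<y _ _ = contradiction (suc-injective eq) (<⇒≢ (countLess-strict x∈ x<y))
... | tri≈ _ x≡y _ = x≡y
... | tri> _ _ y<x = contradiction (suc-injective (sym eq)) (<⇒≢ (countLess-strict y∈ y<x))

stdS-signedPerm : ∀ u → Unique (map ∣_∣ u) → IsSignedPerm (stdS u)
stdS-signedPerm u uniq = isSignedPerm⁺ (stdS u) λ {k} k∈ →
  subst (k ∈_) (sym (∣stdS∣ u)) (covered (subst (λ m → k ∈ positions m) (length-stdS u) k∈))
  where
  a : List ℕ
  a = map ∣_∣ u
  n : ℕ
  n = length u
  std⊆positions : std a ⊆ positions n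
  std⊆positions k∈ with ∈-map⁻ (rank a) k∈
  ... | x , x∈ , refl = ∈-positions⁺ (subst (countLess x a <_) (length-map ∣_∣ u) (countLess-< x∈))
  covered : positions n ⊆ std a
  covered = proj₂ (pigeonhole (Unique-map (rank a) (rank-injectiveOn a) uniq) std⊆positions
    (≤-reflexive (trans (length-positions n) (sym (trans (length-map (rank a) a) (length-map ∣_∣ u))))))

-- The shapes of R₂ₙ and R₂ₙ₊₁

⟦_⟧ : (Word → Bool) → Series
⟦ p ⟧ w = 𝟙 (p w)

upDown : Word → Bool
upDown w = alt true (map ∣_∣ w) ∧ signPat true w

downUp : Word → Bool
downUp []      = false
downUp (x ∷ r) = alt false (map ∣_∣ (x ∷ r)) ∧ pos x ∧ signPat true r

-- rEven and rOdd are the conditions defining R₂ₙ and R₂ₙ₊₁ other than being a signed permutation;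
-- rEven′ and rOdd′ are the same patterns with the other parity of length, i.e. unfinished factors.
rEven rEven′ rOdd rOdd′ : Word → Bool
rEven  w = evenᵇ (length w) ∧ upDown w
rEven′ w = not (evenᵇ (length w)) ∧ upDown w
rOdd   w = not (evenᵇ (length w)) ∧ downUp w
rOdd′  w = evenᵇ (length w) ∧ downUp w

alt-map : ∀ f b as → f PreservesOrderOn as → alt b (map f as) ≡ alt b as
alt-map f b []           pres = refl
alt-map f b (x ∷ [])     pres = refl
alt-map f true  (x ∷ y ∷ as) pres =
  cong₂ _∧_ (pres (here refl) (there (here refl))) (alt-map f false (y ∷ as) λ p q → pres (there p) (there q))
alt-map f false (x ∷ y ∷ as) pres =
  cong₂ _∧_ (pres (there (here refl)) (here refl)) (alt-map f true (y ∷ as) λ p q → pres (there p) (there q))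

pos-withSignOf : ∀ {x} m → x ≢ 0ℤ → pos (withSignOf x (suc m)) ≡ pos x
pos-withSignOf {+ zero}  m x≢0 = contradiction refl x≢0
pos-withSignOf {+ suc _} m x≢0 = refl
pos-withSignOf { -[1+ _ ] } m x≢0 = refl

signPat-relabel : ∀ (g : ℕ → ℕ) b u → All (_≢ 0ℤ) u → signPat b (relabel (λ n → suc (g n)) u) ≡ signPat b u
signPat-relabel g b []      []           = refl
signPat-relabel g true  (x ∷ u) (x≢0 ∷ nz) =
  cong₂ _∧_ (pos-withSignOf (g ∣ x ∣) x≢0) (signPat-relabel g false u nz)
signPat-relabel g false (x ∷ u) (x≢0 ∷ nz) =
  cong₂ _∧_ (cong not (pos-withSignOf (g ∣ x ∣) x≢0)) (signPat-relabel g true u nz)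

module _ (g : ℕ → ℕ) where
  private
    f : ℕ → ℕ
    f n = suc (g n)

  upDown-relabel : ∀ u → f PreservesOrderOn map ∣_∣ u → All (_≢ 0ℤ) u → upDown (relabel f u) ≡ upDown u
  upDown-relabel u pres nz =
    cong₂ _∧_ (trans (cong (alt true) (∣relabel∣ f u)) (alt-map f true _ pres)) (signPat-relabel g true u nz)

  downUp-relabel : ∀ u → f PreservesOrderOn map ∣_∣ u → All (_≢ 0ℤ) u → downUp (relabel f u) ≡ downUp u
  downUp-relabel []      pres nz           = refl
  downUp-relabel (x ∷ r) pres (x≢0 ∷ nz) =
    cong₂ _∧_ (trans (cong (alt false) (∣relabel∣ f (x ∷ r))) (alt-map f false _ pres))
              (cong₂ _∧_ (pos-withSignOf (g ∣ x ∣) x≢0) (signPat-relabel g true r nz))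

rEven-stdS : ∀ u → All (_≢ 0ℤ) u → rEven (stdS u) ≡ rEven u
rEven-stdS u nz rewrite stdS≡relabel u =
  cong₂ _∧_ (cong evenᵇ (length-relabel (rank (map ∣_∣ u)) u))
            (upDown-relabel (λ n → countLess n (map ∣_∣ u)) u (rank-preservesOrder (map ∣_∣ u)) nz)

rOdd-stdS : ∀ u → All (_≢ 0ℤ) u → rOdd (stdS u) ≡ rOdd u
rOdd-stdS u nz rewrite stdS≡relabel u =
  cong₂ _∧_ (cong (not ∘ evenᵇ) (length-relabel (rank (map ∣_∣ u)) u))
            (downUp-relabel (λ n → countLess n (map ∣_∣ u)) u (rank-preservesOrder (map ∣_∣ u)) nz)

inROddᵇ≡ : ∀ w → inROddᵇ w ≡ isSignedPermᵇ w ∧ rOdd w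
inROddᵇ≡ []      = refl
inROddᵇ≡ (_ ∷ _) = refl

Vser-stdS : ∀ u → Good u → Vser (stdS u) ≡ ⟦ rEven ⟧ u
Vser-stdS u (uniq , nz) =
  cong 𝟙 (cong₂ _∧_ (Equivalence.to T-≡ (stdS-signedPerm u uniq)) (rEven-stdS u nz))

Wser-stdS : ∀ u → Good u → Wser (stdS u) ≡ ⟦ rOdd ⟧ u
Wser-stdS u (uniq , nz) = cong 𝟙 (trans (inROddᵇ≡ (stdS u))
  (cong₂ _∧_ (Equivalence.to T-≡ (stdS-signedPerm u uniq)) (rOdd-stdS u nz)))

lastLetter : Word → ℤ
lastLetter w = at w (length w)

-- The two ways y can continue a zigzag ending at a: up to a negative letter, or down to a positive one.
ascentTo descentTo : ℤ → ℤ → Bool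
ascentTo  a y = (∣ a ∣ <ᵇ ∣ y ∣) ∧ not (pos y)
descentTo a y = (∣ y ∣ <ᵇ ∣ a ∣) ∧ pos y

step : Bool → ℤ → ℤ → Bool
step true  = ascentTo
step false = descentTo

flips : ℕ → Bool → Bool
flips zero    b = b
flips (suc n) b = flips n (not b)

flips-not : ∀ n b → flips n (not b) ≡ not (flips n b)
flips-not zero    b = refl
flips-not (suc n) b = flips-not n (not b)

flips-true : ∀ n → flips n true ≡ evenᵇ n
flips-true zero    = refl
flips-true (suc n) = trans (flips-not n true) (cong not (flips-true n))

cmp : Bool → ℕ → ℕ → Bool
cmp b x y = if b then x <ᵇ y else y <ᵇ x

sgn : Bool → ℤ → Bool
sgn b y = if b then pos y else not (pos y)

alt-snoc : ∀ b x r y → alt b (map ∣_∣ ((x ∷ r) ++ [ y ])) ≡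
           alt b (map ∣_∣ (x ∷ r)) ∧ cmp (flips (length r) b) ∣ lastLetter (x ∷ r) ∣ ∣ y ∣
alt-snoc b x []      y = ∧-identityʳ _
alt-snoc b x (z ∷ r) y =
  trans (cong (cmp b ∣ x ∣ ∣ z ∣ ∧_) (alt-snoc (not b) z r y)) (sym (∧-assoc (cmp b ∣ x ∣ ∣ z ∣) _ _))

signPat-snoc : ∀ b w y → signPat b (w ++ [ y ]) ≡ signPat b w ∧ sgn (flips (length w) b) y
signPat-snoc b []      y = ∧-identityʳ _
signPat-snoc b (x ∷ w) y =
  trans (cong (sgn b x ∧_) (signPat-snoc (not b) w y)) (sym (∧-assoc (sgn b x) _ _))

cmp-sgn : ∀ b a y → (cmp b ∣ a ∣ ∣ y ∣ ∧ sgn (not b) y) ≡ step b a y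
cmp-sgn true  a y = refl
cmp-sgn false a y = refl

upDown-snoc : ∀ x r y → upDown ((x ∷ r) ++ [ y ]) ≡ upDown (x ∷ r) ∧ step (flips (length r) true) (lastLetter (x ∷ r)) y
upDown-snoc x r y = begin
  upDown ((x ∷ r) ++ [ y ])
    ≡⟨ cong₂ _∧_ (alt-snoc true x r y) (trans (signPat-snoc true (x ∷ r) y)
                 (cong (λ b → signPat true (x ∷ r) ∧ sgn b y) (flips-not (length r) true))) ⟩
  (alt true (map ∣_∣ (x ∷ r)) ∧ cmp p ∣ l ∣ ∣ y ∣) ∧ (signPat true (x ∷ r) ∧ sgn (not p) y)
    ≡⟨ ∧-interchange (alt true (map ∣_∣ (x ∷ r))) _ (signPat true (x ∷ r)) _ ⟩
  upDown (x ∷ r) ∧ (cmp p ∣ l ∣ ∣ y ∣ ∧ sgn (not p) y)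
    ≡⟨ cong (upDown (x ∷ r) ∧_) (cmp-sgn p l y) ⟩
  upDown (x ∷ r) ∧ step p l y ∎
  where open ≡-Reasoning
        p : Bool
        p = flips (length r) true
        l : ℤ
        l = lastLetter (x ∷ r)

downUp-snoc : ∀ x r y → downUp ((x ∷ r) ++ [ y ]) ≡ downUp (x ∷ r) ∧ step (flips (length r) false) (lastLetter (x ∷ r)) y
downUp-snoc x r y = begin
  downUp ((x ∷ r) ++ [ y ])
    ≡⟨ cong₂ _∧_ (alt-snoc false x r y) (cong (pos x ∧_) (trans (signPat-snoc true r y)
                 (cong (λ b → signPat true r ∧ sgn b y) (flips-not (length r) false)))) ⟩
  (alt false (map ∣_∣ (x ∷ r)) ∧ cmp p ∣ l ∣ ∣ y ∣) ∧ (pos x ∧ (signPat true r ∧ sgn (not p) y))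
    ≡⟨ cong ((alt false (map ∣_∣ (x ∷ r)) ∧ cmp p ∣ l ∣ ∣ y ∣) ∧_) (sym (∧-assoc (pos x) _ _)) ⟩
  (alt false (map ∣_∣ (x ∷ r)) ∧ cmp p ∣ l ∣ ∣ y ∣) ∧ ((pos x ∧ signPat true r) ∧ sgn (not p) y)
    ≡⟨ ∧-interchange (alt false (map ∣_∣ (x ∷ r))) _ (pos x ∧ signPat true r) _ ⟩
  downUp (x ∷ r) ∧ (cmp p ∣ l ∣ ∣ y ∣ ∧ sgn (not p) y)
    ≡⟨ cong (downUp (x ∷ r) ∧_) (cmp-sgn p l y) ⟩
  downUp (x ∷ r) ∧ step p l y ∎
  where open ≡-Reasoning
        p : Bool
        p = flips (length r) false
        l : ℤ
        l = lastLetter (x ∷ r)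

length-snoc : ∀ (w : Word) y → length (w ++ [ y ]) ≡ suc (length w)
length-snoc w y = trans (length-++ w) (+-comm (length w) 1)

rEven-snoc : ∀ w y → rEven (w ++ [ y ]) ≡ rEven′ w ∧ ascentTo (lastLetter w) y
rEven-snoc []      y = refl
rEven-snoc (x ∷ r) y
  rewrite length-snoc r y | upDown-snoc x r y | flips-true (length r) with evenᵇ (length r)
... | true  = refl
... | false = refl

rEven′-snoc : ∀ x r y → rEven′ ((x ∷ r) ++ [ y ]) ≡ rEven (x ∷ r) ∧ descentTo (lastLetter (x ∷ r)) y
rEven′-snoc x r y
  rewrite length-snoc r y | upDown-snoc x r y | flips-true (length r) with evenᵇ (length r)
... | true  = refl
... | false = refl

rOdd-snoc : ∀ x r y → rOdd ((x ∷ r) ++ [ y ]) ≡ rOdd′ (x ∷ r) ∧ ascentTo (lastLetter (x ∷ r)) y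
rOdd-snoc x r y
  rewrite length-snoc r y | downUp-snoc x r y | flips-not (length r) true | flips-true (length r)
  with evenᵇ (length r)
... | true  = refl
... | false = refl

rOdd′-snoc : ∀ w y → rOdd′ (w ++ [ y ]) ≡ rOdd w ∧ descentTo (lastLetter w) y
rOdd′-snoc []      y = refl
rOdd′-snoc (x ∷ r) y
  rewrite length-snoc r y | downUp-snoc x r y | flips-not (length r) true | flips-true (length r)
  with evenᵇ (length r)
... | true  = refl
... | false = refl

infixl 7 _⋆_

-- (A ⊛ B) w unfolds to ((A ∘ stdS) ⋆ (B ∘ stdS)) w.
_⋆_ : Series → Series → Series
(f ⋆ g) w = Σ (suc (length w)) λ k → f (take k w) * g (drop k w)

⋆-cong : ∀ (f f′ g g′ : Series) w →
         (∀ k → f (take k w) ≡ f′ (take k w)) → (∀ k → g (drop k w) ≡ g′ (drop k w)) →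
         (f ⋆ g) w ≡ (f′ ⋆ g′) w
⋆-cong f f′ g g′ w f≈ g≈ = Σ-cong (suc (length w)) λ k _ → cong₂ _*_ (f≈ k) (g≈ k)

⋆-congʳ : ∀ (f g g′ : Series) w → (∀ k → g (drop k w) ≡ g′ (drop k w)) → (f ⋆ g) w ≡ (f ⋆ g′) w
⋆-congʳ f g g′ w = ⋆-cong f f g g′ w (λ _ → refl)

⊛-stdS : ∀ (A B : Series) u → (A ⊛ B) (stdS u) ≡ (A ⊛ B) u
⊛-stdS A B u = trans (cong (λ n → Σ (suc n) term) (length-stdS u))
  (Σ-cong (suc (length u)) λ k _ → cong₂ _*_ (cong A (stdS-take k u)) (cong B (stdS-drop k u)))
  where term : ℕ → ℕ
        term k = A (stdS (take k (stdS u))) * B (stdS (drop k (stdS u)))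

take-snoc : ∀ {A : Set} k (w : List A) x → k ≤ length w → take k (w ++ [ x ]) ≡ take k w
take-snoc zero    w       x _         = refl
take-snoc (suc k) (y ∷ w) x (s≤s k≤w) = cong (y ∷_) (take-snoc k w x k≤w)

drop-snoc : ∀ {A : Set} k (w : List A) x → k ≤ length w → drop k (w ++ [ x ]) ≡ drop k w ++ [ x ]
drop-snoc zero    w       x _         = refl
drop-snoc (suc k) (y ∷ w) x (s≤s k≤w) = drop-snoc k w x k≤w

⋆-snoc : ∀ (f g : Series) w x → (f ⋆ g) (w ++ [ x ]) ≡ (f ⋆ (λ d → g (d ++ [ x ]))) w + f (w ++ [ x ]) * g []
⋆-snoc f g w x = begin
  (f ⋆ g) (w ++ [ x ])
    ≡⟨ cong (λ n → Σ (suc n) term) (length-snoc w x) ⟩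
  Σ (suc (suc (length w))) term
    ≡⟨ Σ-suc (suc (length w)) term ⟩
  Σ (suc (length w)) term + term (suc (length w))
    ≡⟨ cong₂ _+_ (Σ-cong (suc (length w)) λ k k<1+w → cong₂ (λ u v → f u * g v)
                   (take-snoc k w x (≤-pred k<1+w)) (drop-snoc k w x (≤-pred k<1+w)))
                 (cong₂ (λ u v → f u * g v) (take-all _ (w ++ [ x ]) wx≤) (drop-all _ (w ++ [ x ]) wx≤)) ⟩
  (f ⋆ (λ d → g (d ++ [ x ]))) w + f (w ++ [ x ]) * g [] ∎
  where
  open ≡-Reasoning
  term : ℕ → ℕ
  term k = f (take k (w ++ [ x ])) * g (drop k (w ++ [ x ]))
  wx≤ : suc (length w) ≥ length (w ++ [ x ])
  wx≤ = ≤-reflexive (length-snoc w x)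

one-drop : ∀ k (w : Word) → k < length w → one (drop k w) ≡ 0
one-drop zero    (y ∷ w) _         = refl
one-drop (suc k) (y ∷ w) (s≤s k<w) = one-drop k w k<w

⋆-one : ∀ (f : Series) w → (f ⋆ one) w ≡ f w
⋆-one f w = begin
  (f ⋆ one) w
    ≡⟨ Σ-last (length w) (λ k k<w → trans (cong (f (take k w) *_) (one-drop k w k<w)) (*-zeroʳ (f (take k w)))) ⟩
  f (take (length w) w) * one (drop (length w) w)
    ≡⟨ cong₂ (λ u v → f u * one v) (take-all _ w ≤-refl) (drop-all _ w ≤-refl) ⟩
  f w * 1
    ≡⟨ *-identityʳ (f w) ⟩
  f w ∎
  where open ≡-Reasoning

⋆-+ʳ : ∀ (f g h : Series) w → (f ⋆ (λ d → g d + h d)) w ≡ (f ⋆ g) w + (f ⋆ h) w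
⋆-+ʳ f g h w = trans (Σ-cong (suc (length w)) λ k _ → *-distribˡ-+ (f (take k w)) (g (drop k w)) (h (drop k w)))
                     (Σ-distrib-+ (suc (length w)) (λ k → f (take k w) * g (drop k w)) (λ k → f (take k w) * h (drop k w)))

⋆-*ʳ : ∀ (f g : Series) c w → (f ⋆ (λ d → c * g d)) w ≡ c * (f ⋆ g) w
⋆-*ʳ f g c w = trans (Σ-cong (suc (length w)) λ k _ → x∙yz≈y∙xz (f (take k w)) c (g (drop k w)))
                     (Σ-*ˡ (suc (length w)) c (λ k → f (take k w) * g (drop k w)))

lastLetter-drop : ∀ k w {y d} → drop k w ≡ y ∷ d → lastLetter (y ∷ d) ≡ lastLetter w
lastLetter-drop zero    w           refl = refl
lastLetter-drop (suc k) (z ∷ [])    eq   with trans (sym (drop-[] k)) eq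
... | ()
lastLetter-drop (suc k) (z ∷ u ∷ w) eq   = lastLetter-drop k (u ∷ w) eq

⋆-last : ∀ (f g : Series) (h : ℤ → ℕ) w → g [] ≡ 0 →
         (f ⋆ (λ d → h (lastLetter d) * g d)) w ≡ h (lastLetter w) * (f ⋆ g) w
⋆-last f g h w g[]≡0 =
  trans (⋆-congʳ f (λ d → h (lastLetter d) * g d) (λ d → h (lastLetter w) * g d) w weigh) (⋆-*ʳ f g (h (lastLetter w)) w)
  where
  weigh : ∀ k → h (lastLetter (drop k w)) * g (drop k w) ≡ h (lastLetter w) * g (drop k w)
  weigh k with drop k w in eq
  ... | []    rewrite g[]≡0 = trans (*-zeroʳ (h (lastLetter []))) (sym (*-zeroʳ (h (lastLetter w))))
  ... | y ∷ d = cong (λ a → h a * g (y ∷ d)) (lastLetter-drop k w eq)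

module _ (f g : Series) (w : Word) (x : ℤ) where

  ⋆-snoc-last : ∀ (g₂ : Series) (h : ℤ → ℕ) → g₂ [] ≡ 0 →
                (∀ d → g (d ++ [ x ]) ≡ h (lastLetter d) * g₂ d) →
                (f ⋆ g) (w ++ [ x ]) ≡ h (lastLetter w) * (f ⋆ g₂) w + f (w ++ [ x ]) * g []
  ⋆-snoc-last g₂ h g₂[]≡0 rec = trans (⋆-snoc f g w x) (cong (_+ f (w ++ [ x ]) * g [])
    (trans (⋆-congʳ f (λ d → g (d ++ [ x ])) (λ d → h (lastLetter d) * g₂ d) w (λ k → rec (drop k w)))
           (⋆-last f g₂ h w g₂[]≡0)))

  ⋆-snoc-linear : ∀ (g₁ g₂ : Series) c (h : ℤ → ℕ) → g₂ [] ≡ 0 →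
                  (∀ d → g (d ++ [ x ]) ≡ c * g₁ d + h (lastLetter d) * g₂ d) →
                  (f ⋆ g) (w ++ [ x ]) ≡ c * (f ⋆ g₁) w + h (lastLetter w) * (f ⋆ g₂) w + f (w ++ [ x ]) * g []
  ⋆-snoc-linear g₁ g₂ c h g₂[]≡0 rec = trans (⋆-snoc f g w x) (cong (_+ f (w ++ [ x ]) * g []) (begin
    (f ⋆ (λ d → g (d ++ [ x ]))) w
      ≡⟨ ⋆-congʳ f (λ d → g (d ++ [ x ])) (λ d → c * g₁ d + h (lastLetter d) * g₂ d) w (λ k → rec (drop k w)) ⟩
    (f ⋆ (λ d → c * g₁ d + h (lastLetter d) * g₂ d)) w
      ≡⟨ ⋆-+ʳ f (λ d → c * g₁ d) (λ d → h (lastLetter d) * g₂ d) w ⟩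
    (f ⋆ (λ d → c * g₁ d)) w + (f ⋆ (λ d → h (lastLetter d) * g₂ d)) w
      ≡⟨ cong₂ _+_ (⋆-*ʳ f g₁ c w) (⋆-last f g₂ h w g₂[]≡0) ⟩
    c * (f ⋆ g₁) w + h (lastLetter w) * (f ⋆ g₂) w ∎))
    where open ≡-Reasoning

-- Factorisations into words of R-odd shape

rOddPow : ℕ → Series
rOddPow zero    = one
rOddPow (suc j) = rOddPow j ⋆ ⟦ rOdd ⟧

Wser^-stdS : ∀ j v → Good v → (Wser ^ˢ j) (stdS v) ≡ rOddPow j v
Wser^-stdS zero    []      _    = refl
Wser^-stdS zero    (_ ∷ _) _    = refl
Wser^-stdS (suc j) v       good = trans (⊛-stdS (Wser ^ˢ j) Wser v)
  (⋆-cong ((Wser ^ˢ j) ∘ stdS) (rOddPow j) (Wser ∘ stdS) ⟦ rOdd ⟧ v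
     (λ k → Wser^-stdS j (take k v) (good-take k v good)) (λ k → Wser-stdS (drop k v) (good-drop k v good)))

rOddPow-vanish : ∀ j v → length v < j → rOddPow j v ≡ 0
rOddPow-vanish (suc j) v v<1+j = Σ-zero (suc (length v)) λ k _ → term k
  where
  term : ∀ k → rOddPow j (take k v) * ⟦ rOdd ⟧ (drop k v) ≡ 0
  term k with k <? length v
  ... | yes k<v = cong (_* ⟦ rOdd ⟧ (drop k v)) (rOddPow-vanish j (take k v)
                    (subst (_< j) (sym (trans (length-take k v) (m≤n⇒m⊓n≡m (<⇒≤ k<v))))
                           (<-≤-trans k<v (≤-pred v<1+j))))
  ... | no  k≮v rewrite drop-all k v (≮⇒≥ k≮v) = *-zeroʳ (rOddPow j (take k v))

𝟙-∧ : ∀ a b → 𝟙 (a ∧ b) ≡ 𝟙 a * 𝟙 b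
𝟙-∧ true  b = sym (+-identityʳ (𝟙 b))
𝟙-∧ false b = refl

𝟙-∧-swap : ∀ a b → 𝟙 (a ∧ b) ≡ 𝟙 b * 𝟙 a
𝟙-∧-swap a b = trans (𝟙-∧ a b) (*-comm (𝟙 a) (𝟙 b))

⟦rOdd⟧-snoc : ∀ d x → ⟦ rOdd ⟧ (d ++ [ x ]) ≡ 𝟙 (pos x) * one d + 𝟙 (ascentTo (lastLetter d) x) * ⟦ rOdd′ ⟧ d
⟦rOdd⟧-snoc []      x = trans (cong 𝟙 (∧-identityʳ (pos x)))
  (solve 2 (λ p a → p := p :* con 1 :+ a :* con 0) refl (𝟙 (pos x)) (𝟙 (ascentTo 0ℤ x)))
⟦rOdd⟧-snoc (z ∷ r) x = trans (cong 𝟙 (rOdd-snoc z r x))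
  (trans (𝟙-∧-swap (rOdd′ (z ∷ r)) a)
         (solve 3 (λ p a o → a :* o := p :* con 0 :+ a :* o) refl (𝟙 (pos x)) (𝟙 a) (𝟙 (rOdd′ (z ∷ r)))))
  where a : Bool
        a = ascentTo (lastLetter (z ∷ r)) x

⟦rOdd′⟧-snoc : ∀ d x → ⟦ rOdd′ ⟧ (d ++ [ x ]) ≡ 𝟙 (descentTo (lastLetter d) x) * ⟦ rOdd ⟧ d
⟦rOdd′⟧-snoc d x = trans (cong 𝟙 (rOdd′-snoc d x)) (𝟙-∧-swap (rOdd d) _)

⟦rEven⟧-snoc : ∀ w x → ⟦ rEven ⟧ (w ++ [ x ]) ≡ 𝟙 (ascentTo (lastLetter w) x) * ⟦ rEven′ ⟧ w
⟦rEven⟧-snoc w x = trans (cong 𝟙 (rEven-snoc w x)) (𝟙-∧-swap (rEven′ w) _)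

⟦rEven′⟧-snoc : ∀ z r x →
                ⟦ rEven′ ⟧ ((z ∷ r) ++ [ x ]) ≡ 𝟙 (descentTo (lastLetter (z ∷ r)) x) * ⟦ rEven ⟧ (z ∷ r)
⟦rEven′⟧-snoc z r x = trans (cong 𝟙 (rEven′-snoc z r x)) (𝟙-∧-swap (rEven (z ∷ r)) _)

rOddPow-snoc : ∀ j v x → rOddPow (suc j) (v ++ [ x ]) ≡
               𝟙 (pos x) * rOddPow j v + 𝟙 (ascentTo (lastLetter v) x) * (rOddPow j ⋆ ⟦ rOdd′ ⟧) v
rOddPow-snoc j v x = begin
  rOddPow (suc j) (v ++ [ x ])
    ≡⟨ ⋆-snoc-linear (rOddPow j) ⟦ rOdd ⟧ v x one ⟦ rOdd′ ⟧ (𝟙 (pos x)) (λ a → 𝟙 (ascentTo a x)) refl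
                     (λ d → ⟦rOdd⟧-snoc d x) ⟩
  𝟙 (pos x) * (rOddPow j ⋆ one) v + A + rOddPow j (v ++ [ x ]) * 0
    ≡⟨ cong₂ (λ a b → 𝟙 (pos x) * a + A + b) (⋆-one (rOddPow j) v) (*-zeroʳ (rOddPow j (v ++ [ x ]))) ⟩
  𝟙 (pos x) * rOddPow j v + A + 0
    ≡⟨ +-identityʳ _ ⟩
  𝟙 (pos x) * rOddPow j v + A ∎
  where open ≡-Reasoning
        A : ℕ
        A = 𝟙 (ascentTo (lastLetter v) x) * (rOddPow j ⋆ ⟦ rOdd′ ⟧) v

rOddPow′-snoc : ∀ j v x → (rOddPow j ⋆ ⟦ rOdd′ ⟧) (v ++ [ x ]) ≡ 𝟙 (descentTo (lastLetter v) x) * rOddPow (suc j) v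
rOddPow′-snoc j v x = begin
  (rOddPow j ⋆ ⟦ rOdd′ ⟧) (v ++ [ x ])
    ≡⟨ ⋆-snoc-last (rOddPow j) ⟦ rOdd′ ⟧ v x ⟦ rOdd ⟧ (λ a → 𝟙 (descentTo a x)) refl
                   (λ d → ⟦rOdd′⟧-snoc d x) ⟩
  D + rOddPow j (v ++ [ x ]) * 0
    ≡⟨ cong (λ t → D + t) (*-zeroʳ (rOddPow j (v ++ [ x ]))) ⟩
  D + 0
    ≡⟨ +-identityʳ D ⟩
  D ∎
  where open ≡-Reasoning
        D : ℕ
        D = 𝟙 (descentTo (lastLetter v) x) * rOddPow (suc j) v

-- The truncations mirror geomInv; by rOddPow-vanish they lose nothing.
rOddStar rOddStar′ rOddPlus : Series
rOddStar  v = Σ (suc (length v)) λ j → rOddPow j v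
rOddStar′ v = Σ (suc (length v)) λ j → (rOddPow j ⋆ ⟦ rOdd′ ⟧) v
rOddPlus  v = Σ (length v) λ j → rOddPow (suc j) v

geomInv-stdS : ∀ v → Good v → geomInv Wser (stdS v) ≡ rOddStar v
geomInv-stdS v good = trans (cong (λ n → Σ (suc n) λ j → (Wser ^ˢ j) (stdS v)) (length-stdS v))
  (Σ-cong (suc (length v)) λ j _ → Wser^-stdS j v good)

rOddStar-split : ∀ v → rOddStar v ≡ one v + rOddPlus v
rOddStar-split v = Σ-shift (length v) λ j → rOddPow j v

one-snoc : ∀ (v : Word) x → one (v ++ [ x ]) ≡ 0
one-snoc []      x = refl
one-snoc (_ ∷ _) x = refl

rOddStar-snoc : ∀ v x → rOddStar (v ++ [ x ]) ≡ 𝟙 (pos x) * rOddStar v + 𝟙 (ascentTo (lastLetter v) x) * rOddStar′ v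
rOddStar-snoc v x = begin
  rOddStar (v ++ [ x ])
    ≡⟨ cong (λ n → Σ (suc n) λ j → rOddPow j (v ++ [ x ])) (length-snoc v x) ⟩
  Σ (suc (suc (length v))) (λ j → rOddPow j (v ++ [ x ]))
    ≡⟨ Σ-shift (suc (length v)) (λ j → rOddPow j (v ++ [ x ])) ⟩
  one (v ++ [ x ]) + Σ (suc (length v)) (λ j → rOddPow (suc j) (v ++ [ x ]))
    ≡⟨ cong₂ _+_ (one-snoc v x) (Σ-cong (suc (length v)) λ j _ → rOddPow-snoc j v x) ⟩
  Σ (suc (length v)) (λ j → c * rOddPow j v + h * (rOddPow j ⋆ ⟦ rOdd′ ⟧) v)
    ≡⟨ Σ-distrib-+ (suc (length v)) (λ j → c * rOddPow j v) (λ j → h * (rOddPow j ⋆ ⟦ rOdd′ ⟧) v) ⟩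
  Σ (suc (length v)) (λ j → c * rOddPow j v) + Σ (suc (length v)) (λ j → h * (rOddPow j ⋆ ⟦ rOdd′ ⟧) v)
    ≡⟨ cong₂ _+_ (Σ-*ˡ (suc (length v)) c λ j → rOddPow j v)
                 (Σ-*ˡ (suc (length v)) h λ j → (rOddPow j ⋆ ⟦ rOdd′ ⟧) v) ⟩
  c * rOddStar v + h * rOddStar′ v ∎
  where open ≡-Reasoning
        c h : ℕ
        c = 𝟙 (pos x)
        h = 𝟙 (ascentTo (lastLetter v) x)

rOddStar′-snoc : ∀ v x → rOddStar′ (v ++ [ x ]) ≡ 𝟙 (descentTo (lastLetter v) x) * rOddPlus v
rOddStar′-snoc v x = begin
  rOddStar′ (v ++ [ x ])
    ≡⟨ cong (λ n → Σ (suc n) λ j → (rOddPow j ⋆ ⟦ rOdd′ ⟧) (v ++ [ x ])) (length-snoc v x) ⟩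
  Σ (2 + length v) (λ j → (rOddPow j ⋆ ⟦ rOdd′ ⟧) (v ++ [ x ]))
    ≡⟨ Σ-cong (2 + length v) (λ j _ → rOddPow′-snoc j v x) ⟩
  Σ (2 + length v) (λ j → h * rOddPow (suc j) v)
    ≡⟨ Σ-*ˡ (2 + length v) h (λ j → rOddPow (suc j) v) ⟩
  h * Σ (2 + length v) (λ j → rOddPow (suc j) v)
    ≡⟨ cong (h *_) (Σ-extend (length v) 2 λ j v≤j → rOddPow-vanish (suc j) v (s≤s v≤j)) ⟩
  h * rOddPlus v ∎
  where open ≡-Reasoning
        h : ℕ
        h = 𝟙 (descentTo (lastLetter v) x)

-- pending w counts the factorisations of w whose last factor still awaits one more letter.
lhs pending : Series
lhs       = ⟦ rEven ⟧ ⋆ rOddStar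
pending w = (⟦ rEven ⟧ ⋆ rOddStar′) w + ⟦ rEven′ ⟧ w

lhs-snoc : ∀ w x → lhs (w ++ [ x ]) ≡ 𝟙 (pos x) * lhs w + 𝟙 (ascentTo (lastLetter w) x) * pending w
lhs-snoc w x = begin
  lhs (w ++ [ x ])
    ≡⟨ ⋆-snoc-linear ⟦ rEven ⟧ rOddStar w x rOddStar rOddStar′ c (λ a → 𝟙 (ascentTo a x)) refl
                     (λ d → rOddStar-snoc d x) ⟩
  c * lhs w + h * (⟦ rEven ⟧ ⋆ rOddStar′) w + ⟦ rEven ⟧ (w ++ [ x ]) * 1
    ≡⟨ cong (λ e → c * lhs w + h * (⟦ rEven ⟧ ⋆ rOddStar′) w + e * 1) (⟦rEven⟧-snoc w x) ⟩
  c * lhs w + h * (⟦ rEven ⟧ ⋆ rOddStar′) w + h * ⟦ rEven′ ⟧ w * 1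
    ≡⟨ solve 5 (λ c l h t e → c :* l :+ h :* t :+ h :* e :* con 1 := c :* l :+ h :* (t :+ e)) refl
         c (lhs w) h ((⟦ rEven ⟧ ⋆ rOddStar′) w) (⟦ rEven′ ⟧ w) ⟩
  c * lhs w + h * pending w ∎
  where open ≡-Reasoning
        c h : ℕ
        c = 𝟙 (pos x)
        h = 𝟙 (ascentTo (lastLetter w) x)

lhs-split : ∀ w → lhs w ≡ ⟦ rEven ⟧ w + (⟦ rEven ⟧ ⋆ rOddPlus) w
lhs-split w = begin
  lhs w
    ≡⟨ ⋆-congʳ ⟦ rEven ⟧ rOddStar (λ d → one d + rOddPlus d) w (λ k → rOddStar-split (drop k w)) ⟩
  (⟦ rEven ⟧ ⋆ (λ d → one d + rOddPlus d)) w
    ≡⟨ ⋆-+ʳ ⟦ rEven ⟧ one rOddPlus w ⟩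
  (⟦ rEven ⟧ ⋆ one) w + (⟦ rEven ⟧ ⋆ rOddPlus) w
    ≡⟨ cong (_+ (⟦ rEven ⟧ ⋆ rOddPlus) w) (⋆-one ⟦ rEven ⟧ w) ⟩
  ⟦ rEven ⟧ w + (⟦ rEven ⟧ ⋆ rOddPlus) w ∎
  where open ≡-Reasoning

pending-snoc : ∀ w x →
               pending (w ++ [ x ]) ≡ 𝟙 (descentTo (lastLetter w) x) * (⟦ rEven ⟧ ⋆ rOddPlus) w + ⟦ rEven′ ⟧ (w ++ [ x ])
pending-snoc w x = cong (_+ ⟦ rEven′ ⟧ (w ++ [ x ])) (begin
  (⟦ rEven ⟧ ⋆ rOddStar′) (w ++ [ x ])
    ≡⟨ ⋆-snoc-last ⟦ rEven ⟧ rOddStar′ w x rOddPlus (λ a → 𝟙 (descentTo a x)) refl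
                   (λ d → rOddStar′-snoc d x) ⟩
  h * (⟦ rEven ⟧ ⋆ rOddPlus) w + ⟦ rEven ⟧ (w ++ [ x ]) * 0
    ≡⟨ cong (λ t → h * (⟦ rEven ⟧ ⋆ rOddPlus) w + t) (*-zeroʳ (⟦ rEven ⟧ (w ++ [ x ]))) ⟩
  h * (⟦ rEven ⟧ ⋆ rOddPlus) w + 0
    ≡⟨ +-identityʳ _ ⟩
  h * (⟦ rEven ⟧ ⋆ rOddPlus) w ∎)
  where open ≡-Reasoning
        h : ℕ
        h = 𝟙 (descentTo (lastLetter w) x)

pending-single : ∀ x → pending [ x ] ≡ 𝟙 (pos x)
pending-single x = begin
  pending ([] ++ [ x ])
    ≡⟨ pending-snoc [] x ⟩
  𝟙 (descentTo 0ℤ x) * 0 + 𝟙 (pos x ∧ true)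
    ≡⟨ cong₂ _+_ (*-zeroʳ (𝟙 (descentTo 0ℤ x))) (cong 𝟙 (∧-identityʳ (pos x))) ⟩
  𝟙 (pos x) ∎
  where open ≡-Reasoning

pending-snoc-nonempty : ∀ z r x → pending ((z ∷ r) ++ [ x ]) ≡ 𝟙 (descentTo (lastLetter (z ∷ r)) x) * lhs (z ∷ r)
pending-snoc-nonempty z r x = begin
  pending (w ++ [ x ])
    ≡⟨ pending-snoc w x ⟩
  h * (⟦ rEven ⟧ ⋆ rOddPlus) w + ⟦ rEven′ ⟧ (w ++ [ x ])
    ≡⟨ cong (λ t → h * (⟦ rEven ⟧ ⋆ rOddPlus) w + t) (⟦rEven′⟧-snoc z r x) ⟩
  h * (⟦ rEven ⟧ ⋆ rOddPlus) w + h * ⟦ rEven ⟧ w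
    ≡⟨ solve 3 (λ h u e → h :* u :+ h :* e := h :* (e :+ u)) refl h ((⟦ rEven ⟧ ⋆ rOddPlus) w) (⟦ rEven ⟧ w) ⟩
  h * (⟦ rEven ⟧ w + (⟦ rEven ⟧ ⋆ rOddPlus) w)
    ≡⟨ cong (h *_) (lhs-split w) ⟨
  h * lhs w ∎
  where open ≡-Reasoning
        w : Word
        w = z ∷ r
        h : ℕ
        h = 𝟙 (descentTo (lastLetter w) x)

-- Valley-signed words

valleySigned : Word → Bool
valleySigned w = all (valleyCond w) (positions (length w))

endsInDescent : Word → Bool
endsInDescent w = pos (lastLetter w) ∧ ((length w ≡ᵇ 1) ∨ (∣ lastLetter w ∣ <ᵇ ∣ at w (length w ∸ 1) ∣))

at-snoc : ∀ w x i → i ≤ length w → at (w ++ [ x ]) i ≡ at w i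
at-snoc []      x zero          _         = refl
at-snoc (y ∷ w) x zero          _         = refl
at-snoc (y ∷ w) x (suc zero)    _         = refl
at-snoc (y ∷ w) x (suc (suc i)) (s≤s i≤w) = at-snoc w x (suc i) i≤w

at-snoc-last : ∀ w x → at (w ++ [ x ]) (suc (length w)) ≡ x
at-snoc-last []      x = refl
at-snoc-last (y ∷ w) x = at-snoc-last w x

valleyCond-snoc : ∀ w x i → i < length w → valleyCond (w ++ [ x ]) (suc i) ≡ valleyCond w (suc i)
valleyCond-snoc w x zero    i<w rewrite at-snoc w x 1 i<w = refl
valleyCond-snoc w x (suc i) i<w
  rewrite at-snoc w x (suc (suc i)) i<w | at-snoc w x (suc i) (<⇒≤ i<w) | at-snoc w x i (≤-trans (n≤1+n i) (<⇒≤ i<w))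
        | at-snoc w x 1 (≤-trans (s≤s z≤n) i<w) | at-snoc w x 2 (≤-trans (s≤s (s≤s z≤n)) i<w) = refl

all-++ : ∀ {A : Set} (p : A → Bool) xs ys → all p (xs ++ ys) ≡ all p xs ∧ all p ys
all-++ p []       ys = refl
all-++ p (x ∷ xs) ys = trans (cong (p x ∧_) (all-++ p xs ys)) (sym (∧-assoc (p x) _ _))

all-cong : ∀ {A : Set} {p q : A → Bool} xs → (∀ {x} → x ∈ xs → p x ≡ q x) → all p xs ≡ all q xs
all-cong []       eq = refl
all-cong (x ∷ xs) eq = cong₂ _∧_ (eq (here refl)) (all-cong xs (eq ∘ there))

positions-suc : ∀ n → positions (suc n) ≡ positions n ++ [ suc n ]
positions-suc n = trans (cong (map suc) (sym (upTo-∷ʳ n))) (map-++ suc (upTo n) [ n ])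

valleySigned-snoc : ∀ w x → valleySigned (w ++ [ x ]) ≡ valleySigned w ∧ valleyCond (w ++ [ x ]) (suc (length w))
valleySigned-snoc w x = begin
  all V (positions (length (w ++ [ x ])))
    ≡⟨ cong (all V) (trans (cong positions (length-snoc w x)) (positions-suc (length w))) ⟩
  all V (positions (length w) ++ [ suc (length w) ])
    ≡⟨ all-++ V (positions (length w)) [ suc (length w) ] ⟩
  all V (positions (length w)) ∧ (V (suc (length w)) ∧ true)
    ≡⟨ cong₂ _∧_ (all-cong (positions (length w)) earlier) (∧-identityʳ _) ⟩
  valleySigned w ∧ V (suc (length w)) ∎
  where
  open ≡-Reasoning
  V : ℕ → Bool
  V = valleyCond (w ++ [ x ])
  earlier : ∀ {i} → i ∈ positions (length w) → V i ≡ valleyCond w i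
  earlier i∈ with ∈-map⁻ suc i∈
  ... | j , j∈ , refl = valleyCond-snoc w x j (∈-upTo⁻ j∈)

valleyCond-last-pos : ∀ w n → valleyCond (w ++ [ + suc n ]) (suc (length w)) ≡ true
valleyCond-last-pos w n rewrite at-snoc-last w (+ suc n) = refl

<ℤ-+ : ∀ m k → ((+ m) <ℤ (+ k)) ≡ (m <ᵇ k)
<ℤ-+ m k = cong (ℤ._≤ᵇ (+ k)) (cong +_ (+-comm m 1))

pos-<ℤ : ∀ a (F : Bool → Bool → Bool) c d →
         (pos a ∧ F (a <ℤ absℤ c) (a <ℤ absℤ d)) ≡ (pos a ∧ F (∣ a ∣ <ᵇ ∣ c ∣) (∣ a ∣ <ᵇ ∣ d ∣))
pos-<ℤ (+ zero)   F c d = refl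
pos-<ℤ (+ suc m)  F c d = cong₂ F (<ℤ-+ (suc m) ∣ c ∣) (<ℤ-+ (suc m) ∣ d ∣)
pos-<ℤ -[1+ m ]   F c d = refl

neg-[1+] : ∀ n → neg -[1+ n ] ≡ true
neg-[1+] zero    = refl
neg-[1+] (suc n) = refl

valleyCond-last-neg : ∀ w n →
                      valleyCond (w ++ [ -[1+ n ] ]) (suc (length w)) ≡ endsInDescent w ∧ (∣ lastLetter w ∣ <ᵇ suc n)
valleyCond-last-neg []          n rewrite neg-[1+] n = refl
valleyCond-last-neg (a ∷ [])    n rewrite neg-[1+] n =
  trans (pos-<ℤ a (λ _ t → t) -[1+ n ] -[1+ n ]) (cong (_∧ (∣ a ∣ <ᵇ suc n)) (sym (∧-identityʳ (pos a))))
valleyCond-last-neg w@(a ∷ b ∷ r) n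
  rewrite at-snoc-last w -[1+ n ] | neg-[1+] n
        | at-snoc w -[1+ n ] (length w) ≤-refl | at-snoc w -[1+ n ] (suc (length r)) (n≤1+n _) =
  trans (∨-identityʳ _) (trans (pos-<ℤ ℓ _∧_ p -[1+ n ]) (sym (∧-assoc (pos ℓ) _ _)))
  where ℓ p : ℤ
        ℓ = lastLetter w
        p = at w (suc (length r))

lastLetter-snoc : ∀ w x → lastLetter (w ++ [ x ]) ≡ x
lastLetter-snoc w x rewrite length-snoc w x = at-snoc-last w x

endsInDescent-snoc : ∀ z r x → endsInDescent ((z ∷ r) ++ [ x ]) ≡ descentTo (lastLetter (z ∷ r)) x
endsInDescent-snoc z r x
  rewrite lastLetter-snoc (z ∷ r) x | length-snoc r x | at-snoc (z ∷ r) x (suc (length r)) ≤-refl =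
  ∧-comm (pos x) _

valleySigned-snoc-pos : ∀ w n → valleySigned (w ++ [ + suc n ]) ≡ valleySigned w
valleySigned-snoc-pos w n =
  trans (valleySigned-snoc w (+ suc n)) (trans (cong (valleySigned w ∧_) (valleyCond-last-pos w n)) (∧-identityʳ _))

valleySigned-snoc-neg : ∀ w n →
                        valleySigned (w ++ [ -[1+ n ] ]) ≡ valleySigned w ∧ endsInDescent w ∧ (∣ lastLetter w ∣ <ᵇ suc n)
valleySigned-snoc-neg w n = trans (valleySigned-snoc w -[1+ n ]) (cong (valleySigned w ∧_) (valleyCond-last-neg w n))

-- The last-letter recursion

ValleyInvariant : Word → Set
ValleyInvariant w = lhs w ≡ 𝟙 (valleySigned w) × pending w ≡ 𝟙 (valleySigned w ∧ endsInDescent w)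

invariant-snoc-pos : ∀ w n → ValleyInvariant w → ValleyInvariant (w ++ [ + suc n ])
invariant-snoc-pos w n (lhs≡ , _) = lhs-part , pending-part w lhs≡
  where
  open ≡-Reasoning
  x : ℤ
  x = + suc n
  lhs-part : lhs (w ++ [ x ]) ≡ 𝟙 (valleySigned (w ++ [ x ]))
  lhs-part = begin
    lhs (w ++ [ x ])                                       ≡⟨ lhs-snoc w x ⟩
    1 * lhs w + 𝟙 (ascentTo (lastLetter w) x) * pending w  ≡⟨ cong (λ b → 1 * lhs w + 𝟙 b * pending w)
                                                                   (∧-zeroʳ (∣ lastLetter w ∣ <ᵇ suc n)) ⟩
    1 * lhs w + 0                                          ≡⟨ trans (+-identityʳ _) (*-identityˡ _) ⟩
    lhs w                                                  ≡⟨ lhs≡ ⟩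
    𝟙 (valleySigned w)                                     ≡⟨ cong 𝟙 (valleySigned-snoc-pos w n) ⟨
    𝟙 (valleySigned (w ++ [ x ]))                          ∎
  pending-part : ∀ w → lhs w ≡ 𝟙 (valleySigned w) →
                 pending (w ++ [ x ]) ≡ 𝟙 (valleySigned (w ++ [ x ]) ∧ endsInDescent (w ++ [ x ]))
  pending-part []      _    = pending-single x
  pending-part (z ∷ r) lhs≡ = begin
    pending ((z ∷ r) ++ [ x ])                   ≡⟨ pending-snoc-nonempty z r x ⟩
    𝟙 d * lhs (z ∷ r)                            ≡⟨ cong (𝟙 d *_) lhs≡ ⟩
    𝟙 d * 𝟙 (valleySigned (z ∷ r))               ≡⟨ 𝟙-∧-swap (valleySigned (z ∷ r)) d ⟨
    𝟙 (valleySigned (z ∷ r) ∧ d)                 ≡⟨ cong₂ (λ a b → 𝟙 (a ∧ b)) (valleySigned-snoc-pos (z ∷ r) n)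
                                                                             (endsInDescent-snoc z r x) ⟨
    𝟙 (valleySigned ((z ∷ r) ++ [ x ]) ∧ endsInDescent ((z ∷ r) ++ [ x ])) ∎
    where d : Bool
          d = descentTo (lastLetter (z ∷ r)) x

invariant-snoc-neg : ∀ w n → ValleyInvariant w → ValleyInvariant (w ++ [ -[1+ n ] ])
invariant-snoc-neg w n (_ , pending≡) = lhs-part , pending-part w
  where
  open ≡-Reasoning
  x : ℤ
  x = -[1+ n ]
  t : Bool
  t = ∣ lastLetter w ∣ <ᵇ suc n
  lhs-part : lhs (w ++ [ x ]) ≡ 𝟙 (valleySigned (w ++ [ x ]))
  lhs-part = begin
    lhs (w ++ [ x ])                                ≡⟨ lhs-snoc w x ⟩
    𝟙 (t ∧ true) * pending w                        ≡⟨ cong₂ (λ b p → 𝟙 b * p) (∧-identityʳ t) pending≡ ⟩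
    𝟙 t * 𝟙 (valleySigned w ∧ endsInDescent w)      ≡⟨ 𝟙-∧-swap (valleySigned w ∧ endsInDescent w) t ⟨
    𝟙 ((valleySigned w ∧ endsInDescent w) ∧ t)      ≡⟨ cong 𝟙 (∧-assoc (valleySigned w) _ _) ⟩
    𝟙 (valleySigned w ∧ endsInDescent w ∧ t)        ≡⟨ cong 𝟙 (valleySigned-snoc-neg w n) ⟨
    𝟙 (valleySigned (w ++ [ x ]))                   ∎
  pending-part : ∀ w → pending (w ++ [ x ]) ≡ 𝟙 (valleySigned (w ++ [ x ]) ∧ endsInDescent (w ++ [ x ]))
  pending-part []      = trans (pending-single x) (cong 𝟙 (sym (∧-zeroʳ (valleySigned [ x ]))))
  pending-part (z ∷ r) = begin
    pending ((z ∷ r) ++ [ x ])                          ≡⟨ pending-snoc-nonempty z r x ⟩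
    𝟙 (descentTo (lastLetter (z ∷ r)) x) * lhs (z ∷ r)  ≡⟨ cong (λ b → 𝟙 b * lhs (z ∷ r))
                                                               (∧-zeroʳ (suc n <ᵇ ∣ lastLetter (z ∷ r) ∣)) ⟩
    0                                                   ≡⟨ cong 𝟙 (∧-zeroʳ (valleySigned ((z ∷ r) ++ [ x ]))) ⟨
    𝟙 (valleySigned ((z ∷ r) ++ [ x ]) ∧ false)         ≡⟨ cong (λ b → 𝟙 (valleySigned ((z ∷ r) ++ [ x ]) ∧ b))
                                                             (trans (endsInDescent-snoc z r x) (∧-zeroʳ _)) ⟨
    𝟙 (valleySigned ((z ∷ r) ++ [ x ]) ∧ endsInDescent ((z ∷ r) ++ [ x ])) ∎

invariant-snoc : ∀ w x → x ≢ 0ℤ → ValleyInvariant w → ValleyInvariant (w ++ [ x ])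
invariant-snoc w (+ zero)  0≢0 _ = contradiction refl 0≢0
invariant-snoc w (+ suc n) _     = invariant-snoc-pos w n
invariant-snoc w -[1+ n ]  _     = invariant-snoc-neg w n

invariant : ∀ {w} → Reverse w → All (_≢ 0ℤ) w → ValleyInvariant w
invariant []              _  = refl , refl
invariant (w ∶ rw ∶ʳ x) nz with ∷ʳ⁻ nz
... | nzw , x≢0 = invariant-snoc w x x≢0 (invariant rw nzw)

proposition6p5 : ∀ (π : Word) → IsSignedPerm π → (Vser ⊛ geomInv Wser) π ≡ ValleySer π
proposition6p5 π sp = begin
  (Vser ⊛ geomInv Wser) π
    ≡⟨ ⋆-cong (Vser ∘ stdS) ⟦ rEven ⟧ (geomInv Wser ∘ stdS) rOddStar π
         (λ k → Vser-stdS (take k π) (good-take k π good))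
         (λ k → geomInv-stdS (drop k π) (good-drop k π good)) ⟩
  lhs π
    ≡⟨ proj₁ (invariant (reverseView π) (proj₂ good)) ⟩
  𝟙 (valleySigned π)
    ≡⟨ cong (λ b → 𝟙 (b ∧ valleySigned π)) (Equivalence.to T-≡ sp) ⟨
  ValleySer π ∎
  where
  open ≡-Reasoning
  good : Good π
  good = signedPerm⇒good π sp
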